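{- $P_6\le C_5$.
   Context: All graphs are finite and simple, considered up to isomorphism. An edge-colored graph is a pair $(G,c)$ with $c\colon E(G)\to\mathbb{N}$ an arbitrary map (not necessarily proper); it is colored in $t$ or more colors if $|c(E(G))|\ge t$. A subgraph (not necessarily induced) is rainbow if its edges receive pairwise distinct colors. $(G,c)$ is rainbow $H$-free if $G$ contains no rainbow subgraph isomorphic to $H$. For graphs $H_1,H_2$, write $H_1\le H_2$ if there is a positive integer $t$ such that every rainbow $H_1$-free edge-colored complete graph colored in $t$ or more colors is rainbow $H_2$-free. $P_k$ and $C_k$ are the path and the cycle on $k$ vertices. -}

module Defs where

open import Data.Nat using (ℕ; suc)
open import Data.Fin using (Fin; zero; suc; inject₁)
open import Data.Product using (_×_; _,_; Σ; proj₁; proj₂; ∃)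
open import Relation.Binary.PropositionalEquality using (_≡_)
open import Relation.Nullary using (¬_)
open import Function.Definitions using (Injective)

-- A finite simple graph H on vertex set Fin V, given by an
-- enumeration (without repetition) of its E edges.
record Graph : Set where
  field
    V    : ℕ
    E    : ℕ
    edge : Fin E → Fin V × Fin V
open Graph public

-- An edge-colouring of the complete graph K_n on vertex set Fin n:
-- the colour of the unordered edge {i,j} (i ≢ j) is col i j; values
-- col i i are irrelevant (no loops).
record Coloring (n : ℕ) : Set where
  field
    col : Fin n → Fin n → ℕ
    sym : ∀ i j → col i j ≡ col j i
open Coloring public

KEdge : ℕ → Set
KEdge n = Σ (Fin n × Fin n) λ p → ¬ (proj₁ p ≡ proj₂ p)

colorOf : ∀ {n} → Coloring n → KEdge n → ℕ
colorOf c ((i , j) , _) = col c i j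

ColoredInAtLeast : ∀ {n} → Coloring n → ℕ → Set
ColoredInAtLeast {n} c t =
  ∃ λ (f : Fin t → KEdge n) → Injective _≡_ _≡_ (λ k → colorOf c (f k))

-- A rainbow copy of H in (K_n , c): an injective vertex map φ such that
-- the images of the edges of H receive pairwise distinct colours.
-- (Since the host is complete, every injective φ embeds H as a subgraph.)
RainbowCopy : ∀ {n} → Graph → Coloring n → Set
RainbowCopy {n} H c =
  Σ (Fin (V H) → Fin n) λ φ →
    Injective _≡_ _≡_ φ ×
    Injective _≡_ _≡_ (λ e → col c (φ (proj₁ (edge H e))) (φ (proj₂ (edge H e))))

RainbowFree : ∀ {n} → Graph → Coloring n → Set
RainbowFree H c = ¬ RainbowCopy H c

_≼_ : Graph → Graph → Set
H₁ ≼ H₂ = ∃ λ (t : ℕ) → ∀ (n : ℕ) (c : Coloring n) →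
  ColoredInAtLeast c t → RainbowFree H₁ c → RainbowFree H₂ c

-- Path P_{k+1} on k+1 vertices: edges {i, i+1}, i < k.
P : ℕ → Graph
P k = record { V = suc k ; E = k ; edge = λ i → (inject₁ i , suc i) }

P₆ : Graph
P₆ = P 5

C₅ : Graph
C₅ = record { V = 5 ; E = 5 ; edge = e }
  where
  e : Fin 5 → Fin 5 × Fin 5
  e zero = (zero , suc zero)
  e (suc zero) = (suc zero , suc (suc zero))
  e (suc (suc zero)) = (suc (suc zero) , suc (suc (suc zero)))
  e (suc (suc (suc zero))) = (suc (suc (suc zero)) , suc (suc (suc (suc zero))))
  e (suc (suc (suc (suc zero)))) = (suc (suc (suc (suc zero))) , zero)

{-# OPTIONS --safe #-}
-- In a colouring without rainbow P₆, a rainbow path on five vertices is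
-- colour-maximal: an edge from its first vertex to a new vertex repeats one of
-- its colours.  Let C = v₀ … v₄ be a rainbow pentagon.  Applied to the
-- Hamiltonian paths of C in both directions, this gives each edge from an
-- outside vertex w to v₀ the colour of the side v_d v_{d+1} for an offset
-- d ∈ {1,2,3}.  For outside vertices x ≠ w, offset 3 of x (or, by reflection,
-- offset 1) makes x v₀ v₁ v₂ v₃ a rainbow path, and its extension by w shows
-- that xw has a colour of C.  If x has offset 2 at v₀ and w offset 2 at v₁,
-- the same follows from v₀ x w v₁ v₂ and its extension by v₄.  So every
-- colour occurs on the K₅ spanned by C, and there are at most 10 colours.
module Submission where

open import Defs hiding (sym)
open import Data.Empty using (⊥; ⊥-elim)
open import Data.Fin using (Fin; zero; suc; #_; inject₁; splitAt; _↑ˡ_; _↑ʳ_)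
open import Data.Fin.Properties
  using (_≟_; any?; pigeonhole; <⇒≢; inject₁-injective; splitAt-↑ˡ; splitAt-↑ʳ)
open import Data.Nat as ℕ using (ℕ; suc)
open import Data.Nat.Properties using (n<1+n)
open import Data.Product using (∃; _×_; _,_; proj₁; proj₂)
open import Data.Sum using (_⊎_; inj₁; inj₂; [_,_]′)
open import Data.Vec using (Vec; []; _∷_; lookup; tabulate; map)
open import Data.Vec.Properties using (lookup∘tabulate)
open import Data.Vec.Membership.Propositional using (_∈_; _∉_)
open import Data.Vec.Membership.Propositional.Properties using (∈-lookup)
open import Data.Vec.Membership.DecPropositional ℕ._≟_ using (_∈?_)
open import Data.Vec.Relation.Unary.All using (All; []; _∷_)
open import Data.Vec.Relation.Unary.All.Properties using (lookup⁻)
open import Data.Vec.Relation.Unary.AllPairs using ([]; _∷_; allPairs?)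
open import Data.Vec.Relation.Unary.Any using (here; there)
open import Data.Vec.Relation.Unary.Unique.Propositional using (Unique)
open import Data.Vec.Relation.Unary.Unique.Propositional.Properties
  using (lookup-injective; tabulate⁺; map⁺)
open import Function using (_∘_)
open import Function.Definitions using (Injective)
open import Function.Consequences.Propositional
  using (inverseʳ⇒injective; strictlyInverseʳ⇒inverseʳ)
open import Relation.Binary.PropositionalEquality
  using (_≡_; _≢_; ≢-sym; refl; sym; trans; cong; subst; subst₂; module ≡-Reasoning)
open import Relation.Nullary using (Dec; yes; no; ¬?)
open import Relation.Nullary.Decidable using (True; toWitness)
open import Relation.Nullary.Negation using (¬∃⟶∀¬)

module _ {a} {A : Set a} where

  unique-tabulate⁻ : ∀ {m} {f : Fin m → A} → Unique (tabulate f) → Injective _≡_ _≡_ f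
  unique-tabulate⁻ {f = f} distinct {i} {j} fᵢ≡fⱼ = lookup-injective distinct i j (begin
    lookup (tabulate f) i  ≡⟨ lookup∘tabulate f i ⟩
    f i                    ≡⟨ fᵢ≡fⱼ ⟩
    f j                    ≡⟨ lookup∘tabulate f j ⟨
    lookup (tabulate f) j  ∎)
    where open ≡-Reasoning

  ∈-tabulate⁻ : ∀ {m} {f : Fin m → A} {x} → x ∈ tabulate f → ∃ λ i → x ≡ f i
  ∈-tabulate⁻ {suc m} (here x≡f₀)  = zero , x≡f₀
  ∈-tabulate⁻ {suc m} (there x∈fs) with i , x≡fᵢ ← ∈-tabulate⁻ x∈fs = suc i , x≡fᵢ

  ∉⇒All≢ : ∀ {m} {x} {xs : Vec A m} → x ∉ xs → All (x ≢_) xs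
  ∉⇒All≢ {xs = xs} x∉xs = lookup⁻ λ i x≡xᵢ → x∉xs (subst (_∈ xs) (sym x≡xᵢ) (∈-lookup i xs))

  pigeonhole-injective : ∀ {m} (g : Fin (suc m) → A) → Injective _≡_ _≡_ g →
                         (κ : Fin m → A) → (∀ k → ∃ λ i → g k ≡ κ i) → ⊥
  pigeonhole-injective {m} g g-injective κ covered
    with i , j , i<j , same ← pigeonhole (n<1+n m) (λ k → proj₁ (covered k)) =
      <⇒≢ i<j (g-injective (begin
        g i                    ≡⟨ proj₂ (covered i) ⟩
        κ (proj₁ (covered i))  ≡⟨ cong κ same ⟩
        κ (proj₁ (covered j))  ≡⟨ proj₂ (covered j) ⟨
        g j                    ∎))
    where open ≡-Reasoning

distinct-indices : ∀ {m k} (is : Vec (Fin m) k) →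
                   {True (allPairs? (λ i j → ¬? (i ≟ j)) is)} → Unique is
distinct-indices _ {distinct} = toWitness distinct

module Paths {n : ℕ} (c : Coloring n) where

  pathColours : ∀ {k} → Vec (Fin n) (suc k) → Vec ℕ k
  pathColours vs = tabulate λ e → col c (lookup vs (inject₁ e)) (lookup vs (suc e))

  RainbowPath : ∀ {k} → Vec (Fin n) (suc k) → Set
  RainbowPath vs = Unique vs × Unique (pathColours vs)

  rainbowPath⇒copy : ∀ {k} {vs : Vec (Fin n) (suc k)} → RainbowPath vs → RainbowCopy (P k) c
  rainbowPath⇒copy {vs = vs} (distinct , rainbow) =
    lookup vs , lookup-injective distinct _ _ , unique-tabulate⁻ rainbow

  rainbowPath-maximal : ∀ {k} → RainbowFree (P (suc k)) c →
                        ∀ {w a} {vs : Vec (Fin n) k} → RainbowPath (a ∷ vs) → All (w ≢_) (a ∷ vs) →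
                        col c w a ∈ pathColours (a ∷ vs)
  rainbowPath-maximal noPath {w} {a} {vs} (distinct , rainbow) w∉path
    with col c w a ∈? pathColours (a ∷ vs)
  ... | yes old = old
  ... | no  new = ⊥-elim (noPath (rainbowPath⇒copy (w∉path ∷ distinct , ∉⇒All≢ new ∷ rainbow)))

next : Fin 5 → Fin 5
next zero                         = suc zero
next (suc zero)                   = suc (suc zero)
next (suc (suc zero))             = suc (suc (suc zero))
next (suc (suc (suc zero)))       = suc (suc (suc (suc zero)))
next (suc (suc (suc (suc zero)))) = zero

prev : Fin 5 → Fin 5
prev zero                         = suc (suc (suc (suc zero)))
prev (suc zero)                   = zero
prev (suc (suc zero))             = suc zero
prev (suc (suc (suc zero)))       = suc (suc zero)
prev (suc (suc (suc (suc zero)))) = suc (suc (suc zero))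

prev-next : ∀ i → prev (next i) ≡ i
prev-next zero                         = refl
prev-next (suc zero)                   = refl
prev-next (suc (suc zero))             = refl
prev-next (suc (suc (suc zero)))       = refl
prev-next (suc (suc (suc (suc zero)))) = refl

next-injective : Injective _≡_ _≡_ next
next-injective = inverseʳ⇒injective next (strictlyInverseʳ⇒inverseʳ {f⁻¹ = prev} next prev-next)

mirror : Fin 5 → Fin 5
mirror zero                         = zero
mirror (suc zero)                   = suc (suc (suc (suc zero)))
mirror (suc (suc zero))             = suc (suc (suc zero))
mirror (suc (suc (suc zero)))       = suc (suc zero)
mirror (suc (suc (suc (suc zero)))) = suc zero

mirror-involutive : ∀ i → mirror (mirror i) ≡ i
mirror-involutive zero                         = refl
mirror-involutive (suc zero)                   = refl
mirror-involutive (suc (suc zero))             = refl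
mirror-involutive (suc (suc (suc zero)))       = refl
mirror-involutive (suc (suc (suc (suc zero)))) = refl

mirror-injective : Injective _≡_ _≡_ mirror
mirror-injective =
  inverseʳ⇒injective mirror (strictlyInverseʳ⇒inverseʳ {f⁻¹ = mirror} mirror mirror-involutive)

next-mirror-next : ∀ i → next (mirror (next i)) ≡ mirror i
next-mirror-next zero                         = refl
next-mirror-next (suc zero)                   = refl
next-mirror-next (suc (suc zero))             = refl
next-mirror-next (suc (suc (suc zero)))       = refl
next-mirror-next (suc (suc (suc (suc zero)))) = refl

C₅-edge : ∀ e → edge C₅ e ≡ (e , next e)
C₅-edge zero                         = refl
C₅-edge (suc zero)                   = refl
C₅-edge (suc (suc zero))             = refl
C₅-edge (suc (suc (suc zero)))       = refl
C₅-edge (suc (suc (suc (suc zero)))) = refl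

module Pentagons {n : ℕ} (c : Coloring n) where
  open Paths c
  open Coloring c using () renaming (sym to col-sym)

  side : (Fin 5 → Fin n) → Fin 5 → ℕ
  side v i = col c (v i) (v (next i))

  diagonal : (Fin 5 → Fin n) → Fin 5 → ℕ
  diagonal v i = col c (v i) (v (next (next i)))

  mirror-side : ∀ v i → side (v ∘ mirror) i ≡ side v (mirror (next i))
  mirror-side v i = begin
    col c (v (mirror i)) (v (mirror (next i)))
      ≡⟨ col-sym _ _ ⟩
    col c (v (mirror (next i))) (v (mirror i))
      ≡⟨ cong (col c (v (mirror (next i))) ∘ v) (next-mirror-next i) ⟨
    col c (v (mirror (next i))) (v (next (mirror (next i))))
      ∎
    where open ≡-Reasoning

  record RainbowPentagon : Set where
    field
      v              : Fin 5 → Fin n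
      v-injective    : Injective _≡_ _≡_ v
      side-injective : Injective _≡_ _≡_ (side v)

  copy⇒pentagon : RainbowCopy C₅ c → RainbowPentagon
  copy⇒pentagon (φ , φ-injective , edge-injective) = record
    { v              = φ
    ; v-injective    = φ-injective
    ; side-injective = λ {i} {j} eq →
        edge-injective (trans (edge-side i) (trans eq (sym (edge-side j))))
    }
    where
    edge-side : ∀ e → col c (φ (proj₁ (edge C₅ e))) (φ (proj₂ (edge C₅ e))) ≡ side φ e
    edge-side e = cong (λ (i , j) → col c (φ i) (φ j)) (C₅-edge e)

  rotate : RainbowPentagon → RainbowPentagon
  rotate C = record
    { v              = v ∘ next
    ; v-injective    = next-injective ∘ v-injective
    ; side-injective = next-injective ∘ side-injective
    }
    where open RainbowPentagon C

  reflect : RainbowPentagon → RainbowPentagon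
  reflect C = record
    { v              = v ∘ mirror
    ; v-injective    = mirror-injective ∘ v-injective
    ; side-injective = λ {i} {j} eq → next-injective (mirror-injective (side-injective
        (trans (sym (mirror-side v i)) (trans eq (mirror-side v j)))))
    }
    where open RainbowPentagon C

  module _ (C : RainbowPentagon) where
    open RainbowPentagon C

    Outside : Fin n → Set
    Outside w = ∀ i → w ≢ v i

    PentagonColour : ℕ → Set
    PentagonColour α = ∃ λ i → α ≡ side v i

    pentagonColour? : ∀ α → Dec (PentagonColour α)
    pentagonColour? α = any? λ i → α ℕ.≟ side v i

    k₅-colours : Fin (5 ℕ.+ 5) → ℕ
    k₅-colours = [ side v , diagonal v ]′ ∘ splitAt 5

    K₅Colour : ℕ → Set
    K₅Colour α = ∃ λ k → α ≡ k₅-colours k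

    side-colour : ∀ i {α} → α ≡ side v i → K₅Colour α
    side-colour i p = i ↑ˡ 5 , trans p (cong [ side v , diagonal v ]′ (sym (splitAt-↑ˡ 5 i 5)))

    diagonal-colour : ∀ i {α} → α ≡ diagonal v i → K₅Colour α
    diagonal-colour i p = 5 ↑ʳ i , trans p (cong [ side v , diagonal v ]′ (sym (splitAt-↑ʳ 5 5 i)))

    pentagon⇒K₅ : ∀ {α} → PentagonColour α → K₅Colour α
    pentagon⇒K₅ (i , p) = side-colour i p

    v-≢ : ∀ {i j} → i ≢ j → v i ≢ v j
    v-≢ i≢j = i≢j ∘ v-injective

    side-≢ : ∀ {i j} → i ≢ j → side v i ≢ side v j
    side-≢ i≢j = i≢j ∘ side-injective

    hamiltonian : RainbowPath (tabulate v)
    hamiltonian = tabulate⁺ v-injective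
                , tabulate⁺ {f = side v ∘ inject₁} (inject₁-injective ∘ side-injective)

  open RainbowPentagon using (v)

  rotate-colour : ∀ C {α} → PentagonColour (rotate C) α → PentagonColour C α
  rotate-colour C (i , p) = next i , p

  reflect-colour : ∀ C {α} → PentagonColour (reflect C) α → PentagonColour C α
  reflect-colour C (i , p) = mirror (next i) , trans p (mirror-side (v C) i)

  colour-sym : ∀ C {a b} → PentagonColour C (col c a b) → PentagonColour C (col c b a)
  colour-sym C (i , p) = i , trans (col-sym _ _) p

  inner-colour : ∀ C i j → i ≢ j → K₅Colour C (col c (v C i) (v C j))
  inner-colour C zero                         zero                         i≢j = ⊥-elim (i≢j refl)
  inner-colour C zero                         (suc zero)                   _   = side-colour C (# 0) refl
  inner-colour C zero                         (suc (suc zero))             _   = diagonal-colour C (# 0) refl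
  inner-colour C zero                         (suc (suc (suc zero)))       _   = diagonal-colour C (# 3) (col-sym _ _)
  inner-colour C zero                         (suc (suc (suc (suc zero)))) _   = side-colour C (# 4) (col-sym _ _)
  inner-colour C (suc zero)                   zero                         _   = side-colour C (# 0) (col-sym _ _)
  inner-colour C (suc zero)                   (suc zero)                   i≢j = ⊥-elim (i≢j refl)
  inner-colour C (suc zero)                   (suc (suc zero))             _   = side-colour C (# 1) refl
  inner-colour C (suc zero)                   (suc (suc (suc zero)))       _   = diagonal-colour C (# 1) refl
  inner-colour C (suc zero)                   (suc (suc (suc (suc zero)))) _   = diagonal-colour C (# 4) (col-sym _ _)
  inner-colour C (suc (suc zero))             zero                         _   = diagonal-colour C (# 0) (col-sym _ _)
  inner-colour C (suc (suc zero))             (suc zero)                   _   = side-colour C (# 1) (col-sym _ _)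
  inner-colour C (suc (suc zero))             (suc (suc zero))             i≢j = ⊥-elim (i≢j refl)
  inner-colour C (suc (suc zero))             (suc (suc (suc zero)))       _   = side-colour C (# 2) refl
  inner-colour C (suc (suc zero))             (suc (suc (suc (suc zero)))) _   = diagonal-colour C (# 2) refl
  inner-colour C (suc (suc (suc zero)))       zero                         _   = diagonal-colour C (# 3) refl
  inner-colour C (suc (suc (suc zero)))       (suc zero)                   _   = diagonal-colour C (# 1) (col-sym _ _)
  inner-colour C (suc (suc (suc zero)))       (suc (suc zero))             _   = side-colour C (# 2) (col-sym _ _)
  inner-colour C (suc (suc (suc zero)))       (suc (suc (suc zero)))       i≢j = ⊥-elim (i≢j refl)
  inner-colour C (suc (suc (suc zero)))       (suc (suc (suc (suc zero)))) _   = side-colour C (# 3) refl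
  inner-colour C (suc (suc (suc (suc zero)))) zero                         _   = side-colour C (# 4) refl
  inner-colour C (suc (suc (suc (suc zero)))) (suc zero)                   _   = diagonal-colour C (# 4) refl
  inner-colour C (suc (suc (suc (suc zero)))) (suc (suc zero))             _   = diagonal-colour C (# 2) (col-sym _ _)
  inner-colour C (suc (suc (suc (suc zero)))) (suc (suc (suc zero)))       _   = side-colour C (# 3) (col-sym _ _)
  inner-colour C (suc (suc (suc (suc zero)))) (suc (suc (suc (suc zero)))) i≢j = ⊥-elim (i≢j refl)

  module _ (noP₆ : RainbowFree P₆ c) where

    outsider-side₀ : ∀ C {w} → Outside C w →
                     ∃ λ (j : Fin 4) → col c w (v C zero) ≡ side (v C) (inject₁ j)
    outsider-side₀ C o = ∈-tabulate⁻ {f = side (v C) ∘ inject₁}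
      (rainbowPath-maximal noP₆ (hamiltonian C) (o (# 0) ∷ o (# 1) ∷ o (# 2) ∷ o (# 3) ∷ o (# 4) ∷ []))

    outsider-colour₀ : ∀ C {w} → Outside C w → PentagonColour C (col c w (v C zero))
    outsider-colour₀ C o with j , p ← outsider-side₀ C o = inject₁ j , p

    outsider-colour : ∀ C {w} → Outside C w → ∀ i → PentagonColour C (col c w (v C i))
    outsider-colour C o zero =
      outsider-colour₀ C o
    outsider-colour C o (suc zero) =
      rotate-colour C (outsider-colour₀ (rotate C) (o ∘ next))
    outsider-colour C o (suc (suc zero)) =
      rotate-colour C (rotate-colour (rotate C)
        (outsider-colour₀ (rotate (rotate C)) (o ∘ next ∘ next)))
    outsider-colour C o (suc (suc (suc zero))) =
      rotate-colour C (rotate-colour (rotate C) (rotate-colour (rotate (rotate C))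
        (outsider-colour₀ (rotate (rotate (rotate C))) (o ∘ next ∘ next ∘ next))))
    outsider-colour C o (suc (suc (suc (suc zero)))) =
      rotate-colour C (rotate-colour (rotate C) (rotate-colour (rotate (rotate C))
        (rotate-colour (rotate (rotate (rotate C)))
          (outsider-colour₀ (rotate (rotate (rotate (rotate C)))) (o ∘ next ∘ next ∘ next ∘ next)))))

    -- The Hamiltonian path v₀ v₁ v₂ v₃ v₄ rules out offset 4, its reflection
    -- v₀ v₄ v₃ v₂ v₁ offset 0.
    outsider-offset : ∀ C {w} → Outside C w →
                      col c w (v C zero) ≡ side (v C) (# 1)
                      ⊎ col c w (v C zero) ≡ side (v C) (# 2)
                      ⊎ col c w (v C zero) ≡ side (v C) (# 3)
    outsider-offset C o with outsider-side₀ C o | outsider-side₀ (reflect C) (o ∘ mirror)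
    ... | suc zero             , p | _ = inj₁ p
    ... | suc (suc zero)       , p | _ = inj₂ (inj₁ p)
    ... | suc (suc (suc zero)) , p | _ = inj₂ (inj₂ p)
    ... | zero                 , p | j , q = ⊥-elim (reflected-side≢0 j
      (side-injective (trans (sym p) (trans q (mirror-side (v C) (inject₁ j))))))
      where
      open RainbowPentagon C using (side-injective)
      reflected-side≢0 : ∀ (j : Fin 4) → zero ≢ mirror (next (inject₁ j))
      reflected-side≢0 zero                   ()
      reflected-side≢0 (suc zero)             ()
      reflected-side≢0 (suc (suc zero))       ()
      reflected-side≢0 (suc (suc (suc zero))) ()

    offset₃ : ∀ C {x w} → Outside C x → Outside C w → w ≢ x →
              col c x (v C zero) ≡ side (v C) (# 3) → PentagonColour C (col c w x)
    offset₃ C {x} ox ow w≢x x₃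
      with rainbowPath-maximal noP₆ path (w≢x ∷ ow (# 0) ∷ ow (# 1) ∷ ow (# 2) ∷ ow (# 3) ∷ [])
      where
      open RainbowPentagon C using (v-injective; side-injective)
      path : RainbowPath (x ∷ map (v C) (# 0 ∷ # 1 ∷ # 2 ∷ # 3 ∷ []))
      path = (ox (# 0) ∷ ox (# 1) ∷ ox (# 2) ∷ ox (# 3) ∷ [])
             ∷ map⁺ v-injective (distinct-indices _)
           , subst (λ α → Unique (α ∷ map (side (v C)) (# 0 ∷ # 1 ∷ # 2 ∷ []))) (sym x₃)
                   (map⁺ side-injective (distinct-indices (# 3 ∷ # 0 ∷ # 1 ∷ # 2 ∷ [])))
    ... | here p                         = # 3 , trans p x₃
    ... | there (here p)                 = # 0 , p
    ... | there (there (here p))         = # 1 , p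
    ... | there (there (there (here p))) = # 2 , p

    offset₂₂ : ∀ C {x w} → Outside C x → Outside C w → w ≢ x →
               col c x (v C zero) ≡ side (v C) (# 2) → col c w (v C (# 1)) ≡ side (v C) (# 3) →
               PentagonColour C (col c x w)
    offset₂₂ C {x} {w} ox ow w≢x x₂ w₃ with pentagonColour? C (col c x w)
    ... | yes old = old
    ... | no new with rainbowPath-maximal noP₆ path
                        ( v-≢ C (λ ()) ∷ ≢-sym (ox (# 4)) ∷ ≢-sym (ow (# 4))
                        ∷ v-≢ C (λ ()) ∷ v-≢ C (λ ()) ∷ [])
      where
      new≢ : ∀ i → col c x w ≢ side (v C) i
      new≢ i eq = new (i , eq)
      path : RainbowPath (v C zero ∷ x ∷ w ∷ v C (# 1) ∷ v C (# 2) ∷ [])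
      path = (≢-sym (ox (# 0)) ∷ ≢-sym (ow (# 0)) ∷ v-≢ C (λ ()) ∷ v-≢ C (λ ()) ∷ [])
             ∷ (≢-sym w≢x ∷ ox (# 1) ∷ ox (# 2) ∷ [])
             ∷ (ow (# 1) ∷ ow (# 2) ∷ [])
             ∷ (v-≢ C (λ ()) ∷ [])
             ∷ [] ∷ []
           , subst₂ (λ a b → Unique (a ∷ col c x w ∷ b ∷ side (v C) (# 1) ∷ []))
                    (sym (trans (col-sym _ _) x₂)) (sym w₃)
               ( (new≢ (# 2) ∘ sym ∷ side-≢ C (λ ()) ∷ side-≢ C (λ ()) ∷ [])
               ∷ (new≢ (# 3) ∷ new≢ (# 1) ∷ [])
               ∷ (side-≢ C (λ ()) ∷ [])
               ∷ [] ∷ [])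
    ...   | here p                         = ⊥-elim (side-≢ C (λ ()) (trans p (trans (col-sym _ _) x₂)))
    ...   | there (here p)                 = ⊥-elim (new (# 4 , sym p))
    ...   | there (there (here p))         = ⊥-elim (side-≢ C (λ ()) (trans p w₃))
    ...   | there (there (there (here p))) = ⊥-elim (side-≢ C (λ ()) p)

    -- Offset 1 is offset 3 of the reflected pentagon; if x has offset 2,
    -- the offset of w at v₁ decides.
    outsiders-colour : ∀ C {x w} → Outside C x → Outside C w → w ≢ x → PentagonColour C (col c w x)
    outsiders-colour C ox ow w≢x with outsider-offset C ox
    ... | inj₂ (inj₂ x₃) = offset₃ C ox ow w≢x x₃
    ... | inj₁ x₁ = reflect-colour C (offset₃ (reflect C) (ox ∘ mirror) (ow ∘ mirror) w≢x
                                       (trans x₁ (sym (mirror-side (v C) (# 3)))))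
    ... | inj₂ (inj₁ x₂) with outsider-offset (rotate C) (ow ∘ next)
    ...   | inj₂ (inj₁ w₂) = colour-sym C (offset₂₂ C ox ow w≢x x₂ w₂)
    ...   | inj₂ (inj₂ w₃) = colour-sym C (rotate-colour C
      (offset₃ (rotate C) (ow ∘ next) (ox ∘ next) (≢-sym w≢x) w₃))
    ...   | inj₁ w₁ = colour-sym C (rotate-colour C (reflect-colour (rotate C)
      (offset₃ (reflect (rotate C)) (ow ∘ next ∘ mirror) (ox ∘ next ∘ mirror) (≢-sym w≢x)
               (trans w₁ (sym (mirror-side (v (rotate C)) (# 3)))))))

    colorOf-K₅ : ∀ C e → K₅Colour C (colorOf c e)
    colorOf-K₅ C ((a , b) , a≢b) with any? (λ i → a ≟ v C i) | any? (λ j → b ≟ v C j)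
    ... | yes (i , refl) | yes (j , refl) = inner-colour C i j (a≢b ∘ cong (v C))
    ... | yes (i , refl) | no b∉C = pentagon⇒K₅ C (colour-sym C (outsider-colour C (¬∃⟶∀¬ b∉C) i))
    ... | no a∉C | yes (j , refl) = pentagon⇒K₅ C (outsider-colour C (¬∃⟶∀¬ a∉C) j)
    ... | no a∉C | no b∉C = pentagon⇒K₅ C (outsiders-colour C (¬∃⟶∀¬ b∉C) (¬∃⟶∀¬ a∉C) a≢b)

theorem10 : P₆ ≼ C₅
theorem10 = 11 , few-colours
  where
  few-colours : ∀ n (c : Coloring n) → ColoredInAtLeast c 11 → RainbowFree P₆ c → RainbowFree C₅ c
  few-colours n c (edges , rainbow) noP₆ copy =
    pigeonhole-injective (colorOf c ∘ edges) rainbow (k₅-colours C) (colorOf-K₅ noP₆ C ∘ edges)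
    where
    open Pentagons c
    C = copy⇒pentagon copy
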